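{- Let $G$ be a finite connected simple graph with twin classes $C_1,\dots,C_k$, $n_i=|C_i|$, induced subgraphs $G_i=G[C_i]$ (each complete or edgeless), representatives $c_i\in C_i$ and reduced graph $H=G[\{c_1,\dots,c_k\}]$. Then the Wiener index of $G$ is $$W(G)=\sum_{\substack{1\le i\le k\\ G_i\text{ complete}}}\binom{n_i}{2}+\sum_{\substack{1\le i\le k\\ G_i\text{ edgeless}}}2\binom{n_i}{2}+\sum_{1\le i<j\le k} n_in_j\, d_H(c_i,c_j).$$
   Context: $N_G(v)$ is the open neighbourhood of $v$. The twin relation $u\sim^G v$ iff $N_G(u)\setminus\{v\}=N_G(v)\setminus\{u\}$ is an equivalence relation on $V(G)$ whose classes are the twin classes. The Wiener index $W(G)$ is the sum of the distances $d_G(u,v)$ over all unordered pairs of distinct vertices; $d_H$ denotes graph distance in $H$. -}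

module Defs where

open import Data.Nat using (ℕ; zero; suc; _+_; _*_; _≤_)
open import Data.Nat.Combinatorics using (_C_)
open import Data.Bool using (Bool; true; false; if_then_else_; _∧_)
open import Data.Fin using (Fin; toℕ)
import Data.Fin as F
open import Data.List using (List; map; allFin; filter; length)
open import Data.Nat.ListAction using (sum)
open import Data.Bool.ListAction using (and)
open import Data.Product using (Σ; ∃; _×_; _,_)
open import Relation.Nullary using (¬_; does)
open import Relation.Binary.PropositionalEquality using (_≡_; _≢_)

record Graph : Set where
  field
    size : ℕ
    adj  : Fin size → Fin size → Bool
    sym  : ∀ u v → adj u v ≡ adj v u
    irr  : ∀ v → adj v v ≡ false
open Graph public

data Walk (G : Graph) : Fin (size G) → Fin (size G) → ℕ → Set where
  here : ∀ {u} → Walk G u u 0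
  step : ∀ {u v w k} → adj G u v ≡ true → Walk G v w k → Walk G u w (suc k)

Connected : Graph → Set
Connected G = ∀ u v → ∃ λ k → Walk G u v k

IsDist : (G : Graph) → Fin (size G) → Fin (size G) → ℕ → Set
IsDist G u v d = Walk G u v d × (∀ k → Walk G u v k → d ≤ k)

IsDistFun : (G : Graph) → (Fin (size G) → Fin (size G) → ℕ) → Set
IsDistFun G d = ∀ u v → IsDist G u v (d u v)

sumFin : (k : ℕ) → (Fin k → ℕ) → ℕ
sumFin k f = sum (map f (allFin k))

sumPairs : (k : ℕ) → (Fin k → Fin k → ℕ) → ℕ
sumPairs k f = sumFin k λ i → sumFin k λ j → if does (i F.<? j) then f i j else 0

Wiener : (G : Graph) → (Fin (size G) → Fin (size G) → ℕ) → ℕ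
Wiener G d = sumPairs (size G) d

Twin : (G : Graph) → Fin (size G) → Fin (size G) → Set
Twin G u v = ∀ w → w ≢ u → w ≢ v → adj G u w ≡ adj G v w

record TwinClasses (G : Graph) : Set where
  field
    k     : ℕ
    cls   : Fin (size G) → Fin k
    rep   : Fin k → Fin (size G)
    cls-twin : ∀ u v → (cls u ≡ cls v → Twin G u v) × (Twin G u v → cls u ≡ cls v)
    rep-in   : ∀ i → cls (rep i) ≡ i
open TwinClasses public

members : (G : Graph) (T : TwinClasses G) → Fin (k T) → List (Fin (size G))
members G T i = filter (λ v → cls T v F.≟ i) (allFin (size G))

classSize : (G : Graph) (T : TwinClasses G) → Fin (k T) → ℕ
classSize G T i = length (members G T i)

isComplete : (G : Graph) (T : TwinClasses G) → Fin (k T) → Bool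
isComplete G T i = and (map (λ u → and (map (λ v →
    if does (u F.≟ v) then true else adj G u v) (members G T i))) (members G T i))

isEdgeless : (G : Graph) (T : TwinClasses G) → Fin (k T) → Bool
isEdgeless G T i = and (map (λ u → and (map (λ v →
    if adj G u v then false else true) (members G T i))) (members G T i))

reduced : (G : Graph) (T : TwinClasses G) → Graph
reduced G T = record
  { size = k T
  ; adj  = λ i j → adj G (rep T i) (rep T j)
  ; sym  = λ i j → sym G (rep T i) (rep T j)
  ; irr  = λ i → irr G (rep T i)
  }

wienerFormula : (G : Graph) (T : TwinClasses G) → (Fin (k T) → Fin (k T) → ℕ) → ℕ
wienerFormula G T dH =
    sumFin (k T) (λ i → if isComplete G T i then classSize G T i C 2 else 0)
  + sumFin (k T) (λ i → if isEdgeless G T i then 2 * (classSize G T i C 2) else 0)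
  + sumPairs (k T) (λ i j → classSize G T i * classSize G T j * dH i j)

{-# OPTIONS --safe #-}
module Submission where

-- Twins u ≠ v of class i are at distance t_i = 1 if G_i is complete and t_i = 2 otherwise
-- (connectivity gives u a neighbour, which is then also a neighbour of its twin v), while
-- vertices of distinct classes i ≠ j are at distance d_H(c_i, c_j): walks in H lift to G and
-- walks in G project to H. Hence d_G(u, v) + [u = v] t_i = d_H(i, j) + [i = j] t_i for u ∈ C_i,
-- v ∈ C_j; summing over ordered pairs and grouping vertices by class gives
-- 2 W(G) + Σ n_i t_i = 2 Σ_{i<j} n_i n_j d_H + Σ n_i² t_i, and 2 C(n, 2) + n = n² finishes.

open import Defs renaming (sym to adj-sym)
open import Data.Bool using (Bool; true; false; not; if_then_else_)
open import Data.Bool.ListAction using (all)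
open import Data.Bool.Properties using (T-≡; ⇔→≡)
open import Data.Empty using (⊥-elim)
open import Data.Fin using (Fin; zero; suc; _≟_; _<?_)
open import Data.Fin.Properties using (<-cmp)
open import Data.List using (List; []; _∷_; map; filter; length; allFin; tabulate)
open import Data.List.Membership.Propositional using (_∈_)
open import Data.List.Membership.Propositional.Properties using (∈-filter⁺; ∈-filter⁻; ∈-allFin)
open import Data.List.Properties using (map-tabulate)
open import Data.List.Relation.Unary.All as All using (_∷_)
open import Data.List.Relation.Unary.All.Properties using (all⁺; all⁻)
open import Data.List.Relation.Unary.Any using (here; there)
open import Data.List.Relation.Unary.AllPairs using (_∷_)
open import Data.List.Relation.Unary.Unique.Propositional using (Unique)
open import Data.List.Relation.Unary.Unique.Propositional.Properties using (filter⁺; allFin⁺)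
open import Data.Nat using (ℕ; zero; suc; _+_; _*_; _≤_; z≤n; s≤s)
import Data.Nat.ListAction as List
open import Data.Nat.Properties
  using ( +-*-semiring; +-identityʳ; *-identityˡ; *-zeroʳ; *-comm; *-assoc; *-distribˡ-+
        ; ≤-antisym; ≤-trans; m≤n⇒m≤1+n; +-cancelʳ-≡; *-cancelˡ-≡)
open import Data.Nat.Combinatorics using (_C_; nC1≡n; nCk+nC[k+1]≡[n+1]C[k+1])
open import Algebra.Properties.Semiring.Sum +-*-semiring
  using (sum-syntax; sum-cong-≗; sum-replicate-zero; ∑-distrib-+; ∑-comm; *-distribˡ-sum; *-distribʳ-sum)
open import Data.Nat.Tactic.RingSolver using (solve-∀)
open import Data.Product using (∃; ∃₂; _×_; _,_; proj₁; proj₂)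
open import Data.Sum using (_⊎_; inj₁; inj₂)
import Data.Sum as Sum
open import Function using (_∘_; id; case_of_; Equivalence; mk⇔)
open import Relation.Binary.Definitions using (tri<; tri≈; tri>)
open import Relation.Binary.PropositionalEquality
  using (_≡_; _≢_; refl; sym; trans; cong; cong₂; subst; module ≡-Reasoning)
open import Relation.Nullary using (does; yes; no)
open import Relation.Nullary.Decidable using (dec-true; dec-false)
open import Relation.Unary using (Decidable)

open ≡-Reasoning

δ : ∀ {n} → Fin n → Fin n → ℕ
δ i j = if does (i ≟ j) then 1 else 0

δ-refl : ∀ {n} (i : Fin n) → δ i i ≡ 1
δ-refl i rewrite dec-true (i ≟ i) refl = refl

δ-≢ : ∀ {n} {i j : Fin n} → i ≢ j → δ i j ≡ 0
δ-≢ {i = i} {j} i≢j rewrite dec-false (i ≟ j) i≢j = refl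

∑-δ : ∀ {n} (i : Fin n) (f : Fin n → ℕ) → ∑[ j < n ] (δ i j * f j) ≡ f i
∑-δ {suc n} zero    f = trans (cong₂ _+_ (*-identityˡ (f zero)) (sum-replicate-zero n)) (+-identityʳ (f zero))
∑-δ {suc n} (suc i) f = ∑-δ i (f ∘ suc)

sum-tabulate : ∀ {n} (f : Fin n → ℕ) → List.sum (tabulate f) ≡ ∑[ i < n ] f i
sum-tabulate {zero}  f = refl
sum-tabulate {suc n} f = cong (f zero +_) (sum-tabulate (f ∘ suc))

sumFin≡∑ : ∀ n (f : Fin n → ℕ) → sumFin n f ≡ ∑[ i < n ] f i
sumFin≡∑ n f = trans (cong List.sum (map-tabulate id f)) (sum-tabulate f)

length-filter≡sum : ∀ {A : Set} {P : A → Set} (P? : Decidable P) (xs : List A) →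
  length (filter P? xs) ≡ List.sum (map (λ x → if does (P? x) then 1 else 0) xs)
length-filter≡sum P? []       = refl
length-filter≡sum P? (x ∷ xs) with does (P? x)
... | true  = cong suc (length-filter≡sum P? xs)
... | false = length-filter≡sum P? xs

fibreSize : ∀ {n k} → (Fin n → Fin k) → Fin k → ℕ
fibreSize {n} c i = length (filter (λ v → c v ≟ i) (allFin n))

fibreSize≡∑δ : ∀ {n k} (c : Fin n → Fin k) (i : Fin k) → fibreSize c i ≡ ∑[ u < n ] δ (c u) i
fibreSize≡∑δ {n} c i =
  trans (length-filter≡sum (λ v → c v ≟ i) (allFin n)) (sumFin≡∑ n (λ u → δ (c u) i))

∑-fibres : ∀ {n k} (c : Fin n → Fin k) (h : Fin k → ℕ) →
  ∑[ u < n ] h (c u) ≡ ∑[ i < k ] (fibreSize c i * h i)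
∑-fibres {n} {k} c h = sym (begin
  ∑[ i < k ] (fibreSize c i * h i)        ≡⟨ sum-cong-≗ (λ i → trans (cong (_* h i) (fibreSize≡∑δ c i))
                                                                     (*-distribʳ-sum (h i) (λ u → δ (c u) i))) ⟩
  ∑[ i < k ] ∑[ u < n ] (δ (c u) i * h i) ≡⟨ ∑-comm (λ i u → δ (c u) i * h i) ⟩
  ∑[ u < n ] ∑[ i < k ] (δ (c u) i * h i) ≡⟨ sum-cong-≗ (λ u → ∑-δ (c u) h) ⟩
  ∑[ u < n ] h (c u)                      ∎)

∑∑-fibres : ∀ {n k} (c : Fin n → Fin k) (h : Fin k → Fin k → ℕ) →
  ∑[ u < n ] ∑[ v < n ] h (c u) (c v) ≡ ∑[ i < k ] ∑[ j < k ] (fibreSize c i * fibreSize c j * h i j)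
∑∑-fibres {n} {k} c h = begin
  ∑[ u < n ] ∑[ v < n ] h (c u) (c v)
    ≡⟨ sum-cong-≗ (λ u → ∑-fibres c (h (c u))) ⟩
  ∑[ u < n ] ∑[ j < k ] (N j * h (c u) j)
    ≡⟨ ∑-fibres c (λ i → ∑[ j < k ] (N j * h i j)) ⟩
  ∑[ i < k ] (N i * ∑[ j < k ] (N j * h i j))
    ≡⟨ sum-cong-≗ (λ i → *-distribˡ-sum (N i) (λ j → N j * h i j)) ⟩
  ∑[ i < k ] ∑[ j < k ] (N i * (N j * h i j))
    ≡⟨ sum-cong-≗ (λ i → sum-cong-≗ (λ j → *-assoc (N i) (N j) (h i j))) ⟨
  ∑[ i < k ] ∑[ j < k ] (N i * N j * h i j) ∎
  where
  N : Fin k → ℕ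
  N = fibreSize c

upper : ∀ {n} → (Fin n → Fin n → ℕ) → Fin n → Fin n → ℕ
upper f i j = if does (i <? j) then f i j else 0

sumPairs≡∑∑upper : ∀ n (f : Fin n → Fin n → ℕ) → sumPairs n f ≡ ∑[ i < n ] ∑[ j < n ] upper f i j
sumPairs≡∑∑upper n f = trans (sumFin≡∑ n _) (sum-cong-≗ (λ i → sumFin≡∑ n (upper f i)))

module _ {n} {f : Fin n → Fin n → ℕ} (f-sym : ∀ i j → f i j ≡ f j i) (f-diag : ∀ i → f i i ≡ 0) where

  upper-split : ∀ i j → f i j ≡ upper f i j + upper f j i
  upper-split i j with <-cmp i j
  ... | tri< i<j _ j≮i rewrite dec-true (i <? j) i<j | dec-false (j <? i) j≮i = sym (+-identityʳ (f i j))
  ... | tri≈ i≮i refl _ rewrite dec-false (i <? i) i≮i = f-diag i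
  ... | tri> i≮j _ j<i rewrite dec-false (i <? j) i≮j | dec-true (j <? i) j<i = f-sym i j

  ∑∑≡2*sumPairs : ∑[ i < n ] ∑[ j < n ] f i j ≡ 2 * sumPairs n f
  ∑∑≡2*sumPairs = begin
    ∑[ i < n ] ∑[ j < n ] f i j
      ≡⟨ sum-cong-≗ (λ i → sum-cong-≗ (upper-split i)) ⟩
    ∑[ i < n ] ∑[ j < n ] (upper f i j + upper f j i)
      ≡⟨ sum-cong-≗ (λ i → ∑-distrib-+ (upper f i) (λ j → upper f j i)) ⟩
    ∑[ i < n ] (∑[ j < n ] upper f i j + ∑[ j < n ] upper f j i)
      ≡⟨ ∑-distrib-+ (λ i → ∑[ j < n ] upper f i j) _ ⟩
    S + ∑[ i < n ] ∑[ j < n ] upper f j i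
      ≡⟨ cong (S +_) (∑-comm (λ i j → upper f j i)) ⟩
    S + S
      ≡⟨ cong (S +_) (+-identityʳ S) ⟨
    2 * S
      ≡⟨ cong (2 *_) (sumPairs≡∑∑upper n f) ⟨
    2 * sumPairs n f ∎
    where
    S : ℕ
    S = ∑[ i < n ] ∑[ j < n ] upper f i j

module _ {A : Set} (e : A → A → Bool) (xs : List A) where

  all-pairs⁺ : all (λ u → all (e u) xs) xs ≡ true → ∀ {u v} → u ∈ xs → v ∈ xs → e u v ≡ true
  all-pairs⁺ h {u} u∈ v∈ =
    Equivalence.to T-≡ (All.lookup (all⁺ (e u) xs (All.lookup (all⁺ _ xs (Equivalence.from T-≡ h)) u∈)) v∈)

  all-pairs⁻ : (∀ {u v} → u ∈ xs → v ∈ xs → e u v ≡ true) → all (λ u → all (e u) xs) xs ≡ true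
  all-pairs⁻ h =
    Equivalence.to T-≡ (all⁻ _ (All.tabulate λ u∈ →
      all⁻ _ (All.tabulate λ v∈ → Equivalence.from T-≡ (h u∈ v∈))))

two-distinct-or-C2≡0 : ∀ {A : Set} {xs : List A} → Unique xs →
  length xs C 2 ≡ 0 ⊎ ∃₂ λ x y → x ∈ xs × y ∈ xs × x ≢ y
two-distinct-or-C2≡0 {xs = []}        _                = inj₁ refl
two-distinct-or-C2≡0 {xs = _ ∷ []}    _                = inj₁ refl
two-distinct-or-C2≡0 {xs = x ∷ y ∷ _} ((x≢y ∷ _) ∷ _) = inj₂ (x , y , here refl , there (here refl) , x≢y)

2*nC2+n≡n*n : ∀ n → 2 * (n C 2) + n ≡ n * n
2*nC2+n≡n*n zero    = refl
2*nC2+n≡n*n (suc n) = begin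
  2 * (suc n C 2) + suc n      ≡⟨ cong (λ z → 2 * z + suc n) (nCk+nC[k+1]≡[n+1]C[k+1] n 1) ⟨
  2 * (n C 1 + n C 2) + suc n  ≡⟨ cong (λ z → 2 * (z + n C 2) + suc n) (nC1≡n n) ⟩
  2 * (n + n C 2) + suc n      ≡⟨ regroup n (n C 2) ⟩
  suc n + n + (2 * (n C 2) + n) ≡⟨ cong (suc n + n +_) (2*nC2+n≡n*n n) ⟩
  suc n + n + n * n            ≡⟨ square n ⟩
  suc n * suc n                ∎
  where
  regroup : ∀ n c → 2 * (n + c) + suc n ≡ suc n + n + (2 * c + n)
  regroup = solve-∀
  square : ∀ n → suc n + n + n * n ≡ suc n * suc n
  square = solve-∀

complete+edgeless-terms : ∀ bᶜ bᵉ C → C ≡ 0 ⊎ bᵉ ≡ not bᶜ →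
  (if bᶜ then C else 0) + (if bᵉ then 2 * C else 0) ≡ (if bᶜ then 1 else 2) * C
complete+edgeless-terms true  true  .0 (inj₁ refl) = refl
complete+edgeless-terms true  false .0 (inj₁ refl) = refl
complete+edgeless-terms false true  .0 (inj₁ refl) = refl
complete+edgeless-terms false false .0 (inj₁ refl) = refl
complete+edgeless-terms true  .false C (inj₂ refl) = trans (+-identityʳ C) (sym (*-identityˡ C))
complete+edgeless-terms false .true  C (inj₂ refl) = refl

class-term-identity : ∀ bᶜ bᵉ m → m C 2 ≡ 0 ⊎ bᵉ ≡ not bᶜ →
  2 * ((if bᶜ then m C 2 else 0) + (if bᵉ then 2 * (m C 2) else 0)) + m * (if bᶜ then 1 else 2)
    ≡ m * m * (if bᶜ then 1 else 2)
class-term-identity bᶜ bᵉ m h = begin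
  2 * ((if bᶜ then m C 2 else 0) + (if bᵉ then 2 * (m C 2) else 0)) + m * a
    ≡⟨ cong (λ z → 2 * z + m * a) (complete+edgeless-terms bᶜ bᵉ (m C 2) h) ⟩
  2 * (a * (m C 2)) + m * a ≡⟨ factor a (m C 2) m ⟩
  a * (2 * (m C 2) + m)     ≡⟨ cong (a *_) (2*nC2+n≡n*n m) ⟩
  a * (m * m)               ≡⟨ *-comm a (m * m) ⟩
  m * m * a                 ∎
  where
  a : ℕ
  a = if bᶜ then 1 else 2
  factor : ∀ a c m → 2 * (a * c) + m * a ≡ a * (2 * c + m)
  factor = solve-∀

module _ (G : Graph) where

  walk₀⇒≡ : ∀ {u v} → Walk G u v 0 → u ≡ v
  walk₀⇒≡ here = refl

  adj⇒≢ : ∀ {u v} → adj G u v ≡ true → u ≢ v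
  adj⇒≢ {u} uv refl with trans (sym uv) (irr G u)
  ... | ()

  walk-snoc : ∀ {u v w m} → Walk G u v m → adj G v w ≡ true → Walk G u w (suc m)
  walk-snoc here         vw = step vw here
  walk-snoc (step uv' p) vw = step uv' (walk-snoc p vw)

  walk-reverse : ∀ {u v m} → Walk G u v m → Walk G v u m
  walk-reverse here                 = here
  walk-reverse (step {u} {w} uw p) = walk-snoc (walk-reverse p) (trans (adj-sym G w u) uw)

  IsDist-unique : ∀ {u v d e} → IsDist G u v d → IsDist G u v e → d ≡ e
  IsDist-unique (p , d-min) (q , e-min) = ≤-antisym (d-min _ q) (e-min _ p)

  IsDist-reverse : ∀ {u v d} → IsDist G u v d → IsDist G v u d
  IsDist-reverse (p , d-min) = walk-reverse p , λ k q → d-min k (walk-reverse q)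

  dist-sym : ∀ {d} → IsDistFun G d → ∀ u v → d u v ≡ d v u
  dist-sym isd u v = IsDist-unique (IsDist-reverse (isd u v)) (isd v u)

  dist-diag : ∀ {d} → IsDistFun G d → ∀ u → d u u ≡ 0
  dist-diag isd u = IsDist-unique (isd u u) (here , λ _ _ → z≤n)

  IsDist-adjacent : ∀ {u v} → u ≢ v → adj G u v ≡ true → IsDist G u v 1
  IsDist-adjacent {u} {v} u≢v uv = step uv here , minimal
    where
    minimal : ∀ k → Walk G u v k → 1 ≤ k
    minimal zero    p = ⊥-elim (u≢v (walk₀⇒≡ p))
    minimal (suc k) _ = s≤s z≤n

  IsDist-nonadjacent : ∀ {u v} → u ≢ v → adj G u v ≡ false → Walk G u v 2 → IsDist G u v 2
  IsDist-nonadjacent {u} {v} u≢v ¬uv p = p , minimal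
    where
    minimal : ∀ k → Walk G u v k → 2 ≤ k
    minimal zero          q              = ⊥-elim (u≢v (walk₀⇒≡ q))
    minimal (suc zero)    (step uv here) with trans (sym uv) ¬uv
    ... | ()
    minimal (suc (suc k)) _              = s≤s (s≤s z≤n)

module _ (G : Graph) (T : TwinClasses G) where
  private
    H : Graph
    H = reduced G T
    c : Fin (size G) → Fin (k T)
    c = cls T

  twin-adj : ∀ {u u' w} → c u ≡ c u' → w ≢ u → w ≢ u' → adj G u w ≡ adj G u' w
  twin-adj {u} {u'} {w} cu≡cu' = proj₁ (cls-twin T u u') cu≡cu' w

  -- Move one endpoint at a time to its twin; the only obstruction is y = u, where one move suffices.
  adj-class-invariant : ∀ {x y u v} → c x ≡ c u → c y ≡ c v → x ≢ y → u ≢ v → adj G x y ≡ adj G u v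
  adj-class-invariant {x} {y} {u} {v} cx≡cu cy≡cv x≢y u≢v with y ≟ u
  ... | no y≢u = begin
    adj G x y ≡⟨ twin-adj cx≡cu (x≢y ∘ sym) y≢u ⟩
    adj G u y ≡⟨ adj-sym G u y ⟩
    adj G y u ≡⟨ twin-adj cy≡cv (y≢u ∘ sym) u≢v ⟩
    adj G v u ≡⟨ adj-sym G v u ⟩
    adj G u v ∎
  ... | yes refl = trans (twin-adj (trans cx≡cu cy≡cv) (x≢y ∘ sym) u≢v) (adj-sym G v y)

  adj-reduced : ∀ {x y} → c x ≢ c y → adj G x y ≡ adj H (c x) (c y)
  adj-reduced {x} {y} cx≢cy =
    adj-class-invariant (sym (rep-in T (c x))) (sym (rep-in T (c y))) (cx≢cy ∘ cong c) rx≢ry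
    where
    rx≢ry : rep T (c x) ≢ rep T (c y)
    rx≢ry rx≡ry = cx≢cy (trans (sym (rep-in T (c x))) (trans (cong c rx≡ry) (rep-in T (c y))))

  adj-lift : ∀ {a b x y} → adj H a b ≡ true → c x ≡ a → c y ≡ b → adj G x y ≡ true
  adj-lift ab refl refl = trans (adj-reduced (adj⇒≢ H ab)) ab

  walk-lift : ∀ {a b m x y} → Walk H a b (suc m) → c x ≡ a → c y ≡ b → Walk G x y (suc m)
  walk-lift (step ab here)           cx≡a cy≡b = step (adj-lift ab cx≡a cy≡b) here
  walk-lift (step ab rest@(step _ _)) cx≡a cy≡b =
    step (adj-lift ab cx≡a (rep-in T _)) (walk-lift rest (rep-in T _) cy≡b)

  walk-project : ∀ {u v m} → Walk G u v m → ∃ λ m' → m' ≤ m × Walk H (c u) (c v) m'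
  walk-project here = 0 , z≤n , here
  walk-project {u} {v} (step {v = w} uw rest) with walk-project rest | c u ≟ c w
  ... | m' , m'≤m , q | yes cu≡cw = m' , m≤n⇒m≤1+n m'≤m , subst (λ a → Walk H a (c v) m') (sym cu≡cw) q
  ... | m' , m'≤m , q | no cu≢cw  = suc m' , s≤s m'≤m , step (trans (sym (adj-reduced cu≢cw)) uw) q

  IsDist-lift : ∀ {x y d} → c x ≢ c y → IsDist H (c x) (c y) d → IsDist G x y d
  IsDist-lift {d = zero}  cx≢cy (p , _)     = ⊥-elim (cx≢cy (walk₀⇒≡ H p))
  IsDist-lift {d = suc d} cx≢cy (p , d-min) = walk-lift p refl refl , minimal
    where
    minimal : ∀ k → Walk G _ _ k → suc d ≤ k
    minimal k q with walk-project q
    ... | m' , m'≤k , q' = ≤-trans (d-min m' q') m'≤k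

  ∈-members : ∀ {i v} → c v ≡ i → v ∈ members G T i
  ∈-members {i} {v} cv≡i = ∈-filter⁺ (λ u → c u ≟ i) (∈-allFin v) cv≡i

  members-cls : ∀ {i v} → v ∈ members G T i → c v ≡ i
  members-cls {i} v∈ = proj₂ (∈-filter⁻ (λ u → c u ≟ i) {xs = allFin (size G)} v∈)

  members-unique : ∀ i → Unique (members G T i)
  members-unique i = filter⁺ (λ u → c u ≟ i) (allFin⁺ (size G))

  adj-members : ∀ {i u v x y} →
    u ∈ members G T i → v ∈ members G T i → x ∈ members G T i → y ∈ members G T i →
    u ≢ v → x ≢ y → adj G u v ≡ adj G x y
  adj-members u∈ v∈ x∈ y∈ = adj-class-invariant (trans (members-cls u∈) (sym (members-cls x∈)))
                                                (trans (members-cls v∈) (sym (members-cls y∈)))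

  isComplete≡adj : ∀ {i x y} → x ∈ members G T i → y ∈ members G T i → x ≢ y →
    isComplete G T i ≡ adj G x y
  isComplete≡adj {i} {x} {y} x∈ y∈ x≢y = ⇔→≡ (mk⇔ complete⇒adj adj⇒complete)
    where
    entry : Fin (size G) → Fin (size G) → Bool
    entry u v = if does (u ≟ v) then true else adj G u v

    entry-≢ : ∀ {u v} → u ≢ v → entry u v ≡ adj G u v
    entry-≢ {u} {v} u≢v rewrite dec-false (u ≟ v) u≢v = refl

    complete⇒adj : isComplete G T i ≡ true → adj G x y ≡ true
    complete⇒adj h = trans (sym (entry-≢ x≢y)) (all-pairs⁺ entry (members G T i) h x∈ y∈)

    adj⇒complete : adj G x y ≡ true → isComplete G T i ≡ true
    adj⇒complete xy = all-pairs⁻ entry (members G T i) entry-true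
      where
      entry-true : ∀ {u v} → u ∈ members G T i → v ∈ members G T i → entry u v ≡ true
      entry-true {u} {v} u∈ v∈ with u ≟ v
      ... | yes refl = refl
      ... | no u≢v   = trans (adj-members u∈ v∈ x∈ y∈ u≢v x≢y) xy

  isEdgeless≡not-adj : ∀ {i x y} → x ∈ members G T i → y ∈ members G T i → x ≢ y →
    isEdgeless G T i ≡ not (adj G x y)
  isEdgeless≡not-adj {i} {x} {y} x∈ y∈ x≢y = ⇔→≡ (mk⇔ edgeless⇒not-adj not-adj⇒edgeless)
    where
    entry : Fin (size G) → Fin (size G) → Bool
    entry u v = if adj G u v then false else true

    entry≡not : ∀ u v → entry u v ≡ not (adj G u v)
    entry≡not u v with adj G u v
    ... | true  = refl
    ... | false = refl

    entry-refl : ∀ u → entry u u ≡ true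
    entry-refl u rewrite irr G u = refl

    edgeless⇒not-adj : isEdgeless G T i ≡ true → not (adj G x y) ≡ true
    edgeless⇒not-adj h = trans (sym (entry≡not x y)) (all-pairs⁺ entry (members G T i) h x∈ y∈)

    not-adj⇒edgeless : not (adj G x y) ≡ true → isEdgeless G T i ≡ true
    not-adj⇒edgeless ¬xy = all-pairs⁻ entry (members G T i) entry-true
      where
      entry-true : ∀ {u v} → u ∈ members G T i → v ∈ members G T i → entry u v ≡ true
      entry-true {u} {v} u∈ v∈ with u ≟ v
      ... | yes refl = entry-refl u
      ... | no u≢v   = trans (entry≡not u v) (trans (cong not (adj-members u∈ v∈ x∈ y∈ u≢v x≢y)) ¬xy)

  classSize-C2≡0⊎edgeless≡not-complete : ∀ i →
    classSize G T i C 2 ≡ 0 ⊎ isEdgeless G T i ≡ not (isComplete G T i)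
  classSize-C2≡0⊎edgeless≡not-complete i = Sum.map₂ dichotomy (two-distinct-or-C2≡0 (members-unique i))
    where
    dichotomy : (∃₂ λ x y → x ∈ members G T i × y ∈ members G T i × x ≢ y) →
      isEdgeless G T i ≡ not (isComplete G T i)
    dichotomy (x , y , x∈ , y∈ , x≢y) =
      trans (isEdgeless≡not-adj x∈ y∈ x≢y) (cong not (sym (isComplete≡adj x∈ y∈ x≢y)))

  twinDist : Fin (k T) → ℕ
  twinDist i = if isComplete G T i then 1 else 2

  private
    N : Fin (k T) → ℕ
    N = classSize G T

    completeTerm edgelessTerm : Fin (k T) → ℕ
    completeTerm i = if isComplete G T i then N i C 2 else 0
    edgelessTerm i = if isEdgeless G T i then 2 * (N i C 2) else 0

  2*classTerms+∑≡∑ :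
    2 * (sumFin (k T) completeTerm + sumFin (k T) edgelessTerm) + ∑[ i < k T ] (N i * twinDist i)
      ≡ ∑[ i < k T ] (N i * N i * twinDist i)
  2*classTerms+∑≡∑ = begin
    2 * (sumFin (k T) completeTerm + sumFin (k T) edgelessTerm) + A
      ≡⟨ cong (λ z → 2 * z + A)
              (cong₂ _+_ (sumFin≡∑ (k T) completeTerm) (sumFin≡∑ (k T) edgelessTerm)) ⟩
    2 * (∑[ i < k T ] completeTerm i + ∑[ i < k T ] edgelessTerm i) + A
      ≡⟨ cong (λ z → 2 * z + A) (∑-distrib-+ completeTerm edgelessTerm) ⟨
    2 * ∑[ i < k T ] (completeTerm i + edgelessTerm i) + A
      ≡⟨ cong (_+ A) (*-distribˡ-sum 2 (λ i → completeTerm i + edgelessTerm i)) ⟩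
    ∑[ i < k T ] (2 * (completeTerm i + edgelessTerm i)) + A
      ≡⟨ ∑-distrib-+ (λ i → 2 * (completeTerm i + edgelessTerm i)) (λ i → N i * twinDist i) ⟨
    ∑[ i < k T ] (2 * (completeTerm i + edgelessTerm i) + N i * twinDist i)
      ≡⟨ sum-cong-≗ (λ i → class-term-identity (isComplete G T i) (isEdgeless G T i) (N i)
                                               (classSize-C2≡0⊎edgeless≡not-complete i)) ⟩
    ∑[ i < k T ] (N i * N i * twinDist i) ∎
    where
    A = ∑[ i < k T ] (N i * twinDist i)

  twins-common-neighbour : Connected G → ∀ {x y} → x ≢ y → c x ≡ c y → adj G x y ≡ false → Walk G x y 2
  twins-common-neighbour conn {x} {y} x≢y cx≡cy ¬xy with conn x y
  ... | _ , here                   = ⊥-elim (x≢y refl)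
  ... | _ , step {v = w} xw _ = step xw (step wy here)
    where
    w≢y : w ≢ y
    w≢y w≡y with trans (sym xw) (trans (cong (adj G x) w≡y) ¬xy)
    ... | ()
    wy : adj G w y ≡ true
    wy = trans (adj-sym G w y) (trans (sym (twin-adj cx≡cy (adj⇒≢ G xw ∘ sym) w≢y)) xw)

  IsDist-twins : Connected G → ∀ {x y} → x ≢ y → c x ≡ c y → IsDist G x y (twinDist (c x))
  IsDist-twins conn {x} {y} x≢y cx≡cy
    rewrite isComplete≡adj (∈-members refl) (∈-members (sym cx≡cy)) x≢y with adj G x y in xy
  ... | true  = IsDist-adjacent G x≢y xy
  ... | false = IsDist-nonadjacent G x≢y xy (twins-common-neighbour conn x≢y cx≡cy xy)

  module _ (conn : Connected G)
           {dG : Fin (size G) → Fin (size G) → ℕ} (isdG : IsDistFun G dG)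
           {dH : Fin (k T) → Fin (k T) → ℕ} (isdH : IsDistFun H dH) where

    classDist : Fin (k T) → Fin (k T) → ℕ
    classDist i j = dH i j + δ i j * twinDist i

    dist≡classDist : ∀ {u v} → u ≢ v → dG u v ≡ classDist (c u) (c v)
    dist≡classDist {u} {v} u≢v = case c u ≟ c v of λ where
      (yes cu≡cv) → begin
        dG u v                ≡⟨ IsDist-unique G (isdG u v) (IsDist-twins conn u≢v cu≡cv) ⟩
        twinDist (c u)        ≡⟨ cong₂ _+_ (dist-diag H isdH (c u))
                                           (trans (cong (_* twinDist (c u)) (δ-refl (c u))) (*-identityˡ _)) ⟨
        classDist (c u) (c u) ≡⟨ cong (classDist (c u)) cu≡cv ⟩
        classDist (c u) (c v) ∎
      (no cu≢cv) → begin
        dG u v                ≡⟨ IsDist-unique G (isdG u v) (IsDist-lift cu≢cv (isdH (c u) (c v))) ⟩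
        dH (c u) (c v)        ≡⟨ +-identityʳ _ ⟨
        dH (c u) (c v) + 0    ≡⟨ cong (λ z → dH (c u) (c v) + z * twinDist (c u)) (δ-≢ cu≢cv) ⟨
        classDist (c u) (c v) ∎

    dist+δ≡classDist : ∀ u v → dG u v + δ u v * twinDist (c u) ≡ classDist (c u) (c v)
    dist+δ≡classDist u v = case u ≟ v of λ where
      (yes refl) → trans (cong₂ _+_ (dist-diag G isdG u) (cong (_* twinDist (c u)) (δ-refl u)))
                         (sym (cong₂ _+_ (dist-diag H isdH (c u)) (cong (_* twinDist (c u)) (δ-refl (c u)))))
      (no u≢v)   → trans (cong (λ z → dG u v + z * twinDist (c u)) (δ-≢ u≢v))
                         (trans (+-identityʳ (dG u v)) (dist≡classDist u≢v))

    2*Wiener+∑≡∑∑classDist :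
      2 * Wiener G dG + ∑[ i < k T ] (N i * twinDist i) ≡ ∑[ i < k T ] ∑[ j < k T ] (N i * N j * classDist i j)
    2*Wiener+∑≡∑∑classDist = begin
      2 * Wiener G dG + ∑[ i < k T ] (N i * twinDist i)
        ≡⟨ cong₂ _+_ (∑∑≡2*sumPairs (dist-sym G isdG) (dist-diag G isdG)) (∑-fibres c twinDist) ⟨
      ∑∑dG + ∑[ u < size G ] twinDist (c u)
        ≡⟨ cong (∑∑dG +_) (sum-cong-≗ (λ u → ∑-δ u (λ _ → twinDist (c u)))) ⟨
      ∑∑dG + ∑[ u < size G ] ∑[ v < size G ] (δ u v * twinDist (c u))
        ≡⟨ ∑-distrib-+ (λ u → ∑[ v < size G ] dG u v) _ ⟨
      ∑[ u < size G ] (∑[ v < size G ] dG u v + ∑[ v < size G ] (δ u v * twinDist (c u)))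
        ≡⟨ sum-cong-≗ (λ u → ∑-distrib-+ (dG u) _) ⟨
      ∑[ u < size G ] ∑[ v < size G ] (dG u v + δ u v * twinDist (c u))
        ≡⟨ sum-cong-≗ (λ u → sum-cong-≗ (dist+δ≡classDist u)) ⟩
      ∑[ u < size G ] ∑[ v < size G ] classDist (c u) (c v)
        ≡⟨ ∑∑-fibres c classDist ⟩
      ∑[ i < k T ] ∑[ j < k T ] (N i * N j * classDist i j) ∎
      where
      ∑∑dG : ℕ
      ∑∑dG = ∑[ u < size G ] ∑[ v < size G ] dG u v

    ∑∑classDist≡2*sumPairs+∑ :
      ∑[ i < k T ] ∑[ j < k T ] (N i * N j * classDist i j)
        ≡ 2 * sumPairs (k T) (λ i j → N i * N j * dH i j) + ∑[ i < k T ] (N i * N i * twinDist i)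
    ∑∑classDist≡2*sumPairs+∑ = begin
      ∑[ i < k T ] ∑[ j < k T ] (N i * N j * classDist i j)
        ≡⟨ sum-cong-≗ (λ i → sum-cong-≗ (λ j → *-distribˡ-+ (N i * N j) (dH i j) _)) ⟩
      ∑[ i < k T ] ∑[ j < k T ] (f i j + N i * N j * (δ i j * twinDist i))
        ≡⟨ sum-cong-≗ (λ i → ∑-distrib-+ (f i) _) ⟩
      ∑[ i < k T ] (∑[ j < k T ] f i j + ∑[ j < k T ] (N i * N j * (δ i j * twinDist i)))
        ≡⟨ ∑-distrib-+ (λ i → ∑[ j < k T ] f i j) _ ⟩
      ∑[ i < k T ] ∑[ j < k T ] f i j + ∑[ i < k T ] ∑[ j < k T ] (N i * N j * (δ i j * twinDist i))
        ≡⟨ cong₂ _+_ (∑∑≡2*sumPairs f-sym f-diag) (sum-cong-≗ diagonal) ⟩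
      2 * sumPairs (k T) f + ∑[ i < k T ] (N i * N i * twinDist i) ∎
      where
      f : Fin (k T) → Fin (k T) → ℕ
      f i j = N i * N j * dH i j
      f-sym : ∀ i j → f i j ≡ f j i
      f-sym i j = cong₂ _*_ (*-comm (N i) (N j)) (dist-sym H isdH i j)
      f-diag : ∀ i → f i i ≡ 0
      f-diag i = trans (cong (N i * N i *_) (dist-diag H isdH i)) (*-zeroʳ (N i * N i))
      δ-to-front : ∀ a b d t → a * b * (d * t) ≡ d * (a * b * t)
      δ-to-front = solve-∀
      diagonal : ∀ i → ∑[ j < k T ] (N i * N j * (δ i j * twinDist i)) ≡ N i * N i * twinDist i
      diagonal i = trans (sum-cong-≗ (λ j → δ-to-front (N i) (N j) (δ i j) (twinDist i)))
                         (∑-δ i (λ j → N i * N j * twinDist i))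

corollary2p10 : (G : Graph) → Connected G → (T : TwinClasses G)
    → (dG : Fin (size G) → Fin (size G) → ℕ) → IsDistFun G dG
    → (dH : Fin (k T) → Fin (k T) → ℕ) → IsDistFun (reduced G T) dH
    → Wiener G dG ≡ wienerFormula G T dH
corollary2p10 G conn T dG isdG dH isdH =
  *-cancelˡ-≡ W (X + P) 2 (+-cancelʳ-≡ A (2 * W) (2 * (X + P)) (begin
  2 * W + A           ≡⟨ 2*Wiener+∑≡∑∑classDist G T conn isdG isdH ⟩
  _                   ≡⟨ ∑∑classDist≡2*sumPairs+∑ G T conn isdG isdH ⟩
  2 * P + Q           ≡⟨ cong (2 * P +_) (2*classTerms+∑≡∑ G T) ⟨
  2 * P + (2 * X + A) ≡⟨ swap P X A ⟩
  2 * (X + P) + A     ∎))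
  where
  N : Fin (k T) → ℕ
  N = classSize G T
  W X P A Q : ℕ
  W = Wiener G dG
  X = sumFin (k T) (λ i → if isComplete G T i then N i C 2 else 0)
    + sumFin (k T) (λ i → if isEdgeless G T i then 2 * (N i C 2) else 0)
  P = sumPairs (k T) (λ i j → N i * N j * dH i j)
  A = ∑[ i < k T ] (N i * twinDist G T i)
  Q = ∑[ i < k T ] (N i * N i * twinDist G T i)
  swap : ∀ p x a → 2 * p + (2 * x + a) ≡ 2 * (x + p) + a
  swap = solve-∀
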